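{- Let $n\ge1$ and $\kappa>0$. The embedding $\iota^{\mathrm{B}}_{\mathsf{B}}\colon\mathcal{F}^{\mathrm{B}}_\kappa(\mathsf{B}'^n)\to\mathcal{F}^{\mathrm{B}}_{\kappa/2}(\mathsf{A}^{2n})$ satisfies $\iota^{\mathrm{B}}_{\mathsf{B}}\circ\mathbf{t}_i=\mathbf{t}_i\circ\iota^{\mathrm{B}}_{\mathsf{B}}$ for every $0\le i\le 2n-1$ (rank toggles of $\mathsf{B}'^n$ on the left, of $\mathsf{A}^{2n}$ on the right); in particular it intertwines $\rho^{\mathrm{B}}_{\mathcal{F}}$ and $\mathrm{rvac}^{\mathrm{B}}_{\mathcal{F}}$ of the two posets.
   Context: $\mathsf{A}^{2n}$ is the poset of intervals $[i,j]\subseteq\{1,\dots,2n\}$, $i\le j$, ordered by inclusion, graded with rank $j-i$ (rank $2n-1$); $\mathrm{Flip}([i,j])=[2n+1-j,2n+1-i]$. $\mathsf{B}'^n=\mathsf{A}^{2n}/\langle\mathrm{Flip}\rangle$, the poset of $\mathrm{Flip}$-orbits with $Gp\le Gq$ iff $p\le q$ for some representatives, ranks induced (rank $2n-1$). For a graded poset $\mathsf{P}$ of rank $r$, $\widehat{\mathsf{P}}$ adds minimum $\widehat0$, maximum $\widehat1$ ($\lessdot$ = covering in $\widehat{\mathsf{P}}$); $\mathcal{F}^{\mathrm{B}}_\kappa(\mathsf{P})$ = maps $\widehat{\mathsf{P}}\to\mathbb{R}_{>0}$ with $\pi(\widehat0)=1,\pi(\widehat1)=\kappa$; toggle $t_p$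 changes only the value at $p$, to $\frac{\sum_{y\lessdot p}\pi(y)}{\pi(p)\sum_{p\lessdot y}1/\pi(y)}$; $\mathbf{t}_i=\prod_{\mathrm{rk}(p)=i}t_p$; compositions rightmost first; $\rho^{\mathrm{B}}_{\mathcal{F}}=\mathbf{t}_0\cdots\mathbf{t}_r$; $\mathrm{rvac}^{\mathrm{B}}_{\mathcal{F}}=(\mathbf{t}_r)(\mathbf{t}_{r-1}\mathbf{t}_r)\cdots(\mathbf{t}_1\cdots\mathbf{t}_r)(\mathbf{t}_0\cdots\mathbf{t}_r)$. The embedding is $(\iota^{\mathrm{B}}_{\mathsf{B}}\pi)(p)=\pi(\langle\mathrm{Flip}\rangle p)$ for $p\in\mathsf{A}^{2n}$, with $\widehat0\mapsto1$, $\widehat1\mapsto\kappa/2$. -}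

module Defs where

open import Level using (0ℓ)
open import Data.Nat as ℕ using (ℕ; zero; suc; _∸_; _≤ᵇ_; _≟_)
import Data.Nat.Properties as ℕP
open import Data.Bool using (Bool; _∧_; if_then_else_)
open import Data.Product using (_×_; _,_; proj₁; proj₂)
open import Data.Sum using (_⊎_)
open import Data.Unit using (⊤; tt)
open import Data.Empty using (⊥)
open import Data.List using (List; []; _∷_; map; foldl; filter; filterᵇ; concatMap; upTo; downFrom)
open import Data.List.Relation.Unary.All using (All; all?)
open import Relation.Nullary using (¬_; Dec; yes; no; ¬?)
open import Relation.Nullary.Decidable using (_×-dec_; _⊎-dec_)
open import Relation.Binary using (Rel; Decidable)
open import Algebra.Core using (Op₁; Op₂)
open import Algebra.Structures using (IsCommutativeSemigroup; IsCommutativeMonoid)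
import Algebra.Definitions as AD

-- We work
-- over an arbitrary "positive semifield" (commutative semiring without
-- zero in which every element is invertible); ℝ_{>0} is an instance.

record PosSemifield : Set₁ where
  infixl 7 _*_
  infixl 6 _+_
  infix  4 _≈_
  field
    Carrier  : Set
    _≈_      : Rel Carrier 0ℓ
    _+_      : Op₂ Carrier
    _*_      : Op₂ Carrier
    1#       : Carrier
    _⁻¹      : Op₁ Carrier
    +-isCommutativeSemigroup : IsCommutativeSemigroup _≈_ _+_
    *-isCommutativeMonoid    : IsCommutativeMonoid _≈_ _*_ 1#
    distribʳ : AD._DistributesOverʳ_ _≈_ _*_ _+_
    ⁻¹-cong  : AD.Congruent₁ _≈_ _⁻¹
    inverseʳ : AD.RightInverse _≈_ 1# _⁻¹ _*_

record GPoset : Set₁ where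
  field
    X     : Set
    elems : List X
    _≤_   : X → X → Set
    _≤?_  : Decidable _≤_
    rank  : X → ℕ

data Hat (X : Set) : Set where
  bot : Hat X
  el  : X → Hat X
  top : Hat X

module Toggles (S : PosSemifield) (P : GPoset) where
  open PosSemifield S
  open GPoset P

  _≤̂_ : Hat X → Hat X → Set
  bot  ≤̂ _    = ⊤
  el x ≤̂ el y = x ≤ y
  el x ≤̂ top  = ⊤
  el x ≤̂ bot  = ⊥
  top  ≤̂ top  = ⊤
  top  ≤̂ bot  = ⊥
  top  ≤̂ el _ = ⊥

  _≤̂?_ : Decidable _≤̂_
  bot  ≤̂? _    = yes tt
  el x ≤̂? el y = x ≤? y
  el x ≤̂? top  = yes tt
  el x ≤̂? bot  = no (λ ())
  top  ≤̂? top  = yes tt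
  top  ≤̂? bot  = no (λ ())
  top  ≤̂? el _ = no (λ ())

  _<̂_ : Hat X → Hat X → Set
  a <̂ b = (a ≤̂ b) × ¬ (b ≤̂ a)

  _<̂?_ : Decidable _<̂_
  a <̂? b = (a ≤̂? b) ×-dec ¬? (b ≤̂? a)

  hatElems : List (Hat X)
  hatElems = bot ∷ top ∷ map el elems

  _⋖_ : Hat X → Hat X → Set
  a ⋖ b = (a <̂ b) × All (λ c → ¬ ((a <̂ c) × (c <̂ b))) hatElems

  _⋖?_ : Decidable _⋖_
  a ⋖? b = (a <̂? b) ×-dec all? (λ c → ¬? ((a <̂? c) ×-dec (c <̂? b))) hatElems

  -- a labelling in F^B_κ(P): its values on P (0̂ ↦ 1, 1̂ ↦ κ are fixed)
  Lab : Set
  Lab = X → Carrier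

  val : Carrier → Lab → Hat X → Carrier
  val κ π bot    = 1#
  val κ π (el x) = π x
  val κ π top    = κ

  -- sum of a list (only ever applied to nonempty lists: every element
  -- of a finite P̂∖{0̂,1̂} has a lower and an upper cover)
  sum⁺ : List Carrier → Carrier
  sum⁺ []       = 1#
  sum⁺ (x ∷ xs) = foldl _+_ x xs

  lowerCovers upperCovers : Hat X → List (Hat X)
  lowerCovers p = filter (λ y → y ⋖? p) hatElems
  upperCovers p = filter (λ y → p ⋖? y) hatElems

  toggleVal : Carrier → Lab → X → Carrier
  toggleVal κ π p =
    sum⁺ (map (val κ π) (lowerCovers (el p)))
      * (π p * sum⁺ (map (λ y → (val κ π y) ⁻¹) (upperCovers (el p)))) ⁻¹

  -- rank toggle t_i = product of the (pairwise commuting) t_p, rk p = i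
  t : Carrier → ℕ → Lab → Lab
  t κ i π x with rank x ≟ i
  ... | yes _ = toggleVal κ π x
  ... | no  _ = π x

  tSeq : Carrier → List ℕ → Lab → Lab
  tSeq κ []       π = π
  tSeq κ (i ∷ is) π = t κ i (tSeq κ is π)

  range : ℕ → ℕ → List ℕ
  range k r = map (λ m → k ℕ.+ m) (upTo (suc r ∸ k))

  rho : Carrier → ℕ → Lab → Lab
  rho κ r = tSeq κ (range 0 r)

  -- rvac = (t_r)(t_{r-1} t_r) ⋯ (t_0 ⋯ t_r)
  rvacSeq : Carrier → ℕ → List ℕ → Lab → Lab
  rvacSeq κ r []       π = π
  rvacSeq κ r (k ∷ ks) π = tSeq κ (range k r) (rvacSeq κ r ks π)

  rvac : Carrier → ℕ → Lab → Lab
  rvac κ r = rvacSeq κ r (downFrom (suc r))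

  _≋_ : Lab → Lab → Set
  π ≋ σ = All (λ p → π p ≈ σ p) elems

-- The posets.  Intervals [i,j] ⊆ {1,…,2n} are pairs (i , j) of naturals.

Pair : Set
Pair = ℕ × ℕ

pairs : ℕ → List Pair
pairs m = concatMap (λ i → map (λ j → (i , j)) (upTo (suc m))) (upTo (suc m))

validA : ℕ → Pair → Bool
validA n (i , j) = (1 ≤ᵇ i) ∧ (i ≤ᵇ j) ∧ (j ≤ᵇ (2 ℕ.* n))

_⊆I_ : Pair → Pair → Set
(i , j) ⊆I (k , l) = (k ℕ.≤ i) × (j ℕ.≤ l)

_⊆I?_ : Decidable _⊆I_
(i , j) ⊆I? (k , l) = (k ℕP.≤? i) ×-dec (j ℕP.≤? l)

rankI : Pair → ℕ
rankI (i , j) = j ∸ i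

Flip : ℕ → Pair → Pair
Flip n (i , j) = (suc (2 ℕ.* n) ∸ j , suc (2 ℕ.* n) ∸ i)

A : ℕ → GPoset
A n = record
  { X = Pair
  ; elems = filterᵇ (validA n) (pairs (2 ℕ.* n))
  ; _≤_ = _⊆I_
  ; _≤?_ = _⊆I?_
  ; rank = rankI }

-- Flip-orbits are represented by the canonical representative (i , j)
-- with i + j ≤ 2n+1 (the orbit {[i,j], Flip [i,j]} contains exactly
-- one such interval, or the interval is Flip-fixed).
canonical : ℕ → Pair → Bool
canonical n (i , j) = (i ℕ.+ j) ≤ᵇ suc (2 ℕ.* n)

canon : ℕ → Pair → Pair
canon n p = if canonical n p then p else Flip n p

-- Gp ≤ Gq iff p' ≤ q' for some representatives p' ∈ Gp, q' ∈ Gq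
_≤B[_]_ : Pair → ℕ → Pair → Set
p ≤B[ n ] q = (p ⊆I q) ⊎ (Flip n p ⊆I q) ⊎ (p ⊆I Flip n q) ⊎ (Flip n p ⊆I Flip n q)

≤B? : (n : ℕ) → Decidable (λ p q → p ≤B[ n ] q)
≤B? n p q = (p ⊆I? q) ⊎-dec (Flip n p ⊆I? q) ⊎-dec (p ⊆I? Flip n q)
            ⊎-dec (Flip n p ⊆I? Flip n q)

-- the poset B'^n = A^{2n}/⟨Flip⟩
B' : ℕ → GPoset
B' n = record
  { X = Pair
  ; elems = filterᵇ (λ p → validA n p ∧ canonical n p) (pairs (2 ℕ.* n))
  ; _≤_ = λ p q → p ≤B[ n ] q
  ; _≤?_ = ≤B? n
  ; rank = rankI }

ι : (S : PosSemifield) (n : ℕ) → Toggles.Lab S (B' n) → Toggles.Lab S (A n)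
ι S n π p = π (canon n p)

half : (S : PosSemifield) → PosSemifield.Carrier S → PosSemifield.Carrier S
half S κ = κ * (1# + 1#) ⁻¹
  where open PosSemifield S

module Submission where

-- In Â^{2n} an interval [i , j] is covered by [i , j-1] and [i+1 , j] (by 0̂ when i = j), and it is
-- covered by those of [i-1 , j] and [i , j+1] that exist (by 1̂ when [i , j] = [1 , 2n]). In B̂'^n the
-- covers of an orbit are the orbits of the covers of a representative, and the two covers collapse
-- into one orbit exactly when [i , j] is Flip-fixed, i.e. i + j = 2n+1. So at a Flip-fixed interval
-- both sums of the toggle formula are twice those of B'^n and the factor 2 cancels; for the upper
-- sum of [1 , 2n] the doubling comes from 1/(κ/2) = 1/κ + 1/κ. Thus ι commutes with every rank
-- toggle, hence with ρ and rvac, which are composites of rank toggles.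

open import Defs
import Data.Nat as ℕ
open ℕ using (ℕ)

module PosSemifieldProperties (S : PosSemifield) where
  open PosSemifield S
  open import Algebra.Bundles using (AbelianGroup)
  open import Algebra.Structures using (IsCommutativeSemigroup; IsCommutativeMonoid)
  open import Data.Product using (_,_)

  *-abelianGroup : AbelianGroup _ _
  *-abelianGroup = record
    { Carrier = Carrier ; _≈_ = _≈_ ; _∙_ = _*_ ; ε = 1# ; _⁻¹ = _⁻¹
    ; isAbelianGroup = record
      { isGroup = record
        { isMonoid = isMonoid
        ; inverse = (λ x → trans (comm (x ⁻¹) x) (inverseʳ x)) , inverseʳ
        ; ⁻¹-cong = ⁻¹-cong }
      ; comm = comm } }
    where open IsCommutativeMonoid *-isCommutativeMonoid

  open AbelianGroup *-abelianGroup using (setoid; ∙-cong; ∙-congˡ; assoc; comm; identityˡ; identityʳ)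
  open import Algebra.Properties.AbelianGroup *-abelianGroup using (⁻¹-∙-comm; ⁻¹-involutive)
  open import Algebra.Properties.CommutativeSemigroup (AbelianGroup.commutativeSemigroup *-abelianGroup) using (interchange)
  open IsCommutativeSemigroup +-isCommutativeSemigroup using () renaming (∙-cong to +-cong)
  open import Relation.Binary.Reasoning.Setoid setoid

  2# : Carrier
  2# = 1# + 1#

  x+x≈x*2 : ∀ x → x + x ≈ x * 2#
  x+x≈x*2 x = begin
    x + x            ≈⟨ +-cong (identityˡ x) (identityˡ x) ⟨
    1# * x + 1# * x  ≈⟨ distribʳ x 1# 1# ⟨
    2# * x           ≈⟨ comm 2# x ⟩
    x * 2#           ∎

  *-cancelʳ-quotient : ∀ a b c → (a * c) * (b * c) ⁻¹ ≈ a * b ⁻¹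
  *-cancelʳ-quotient a b c = begin
    (a * c) * (b * c) ⁻¹     ≈⟨ ∙-congˡ (⁻¹-∙-comm b c) ⟨
    (a * c) * (b ⁻¹ * c ⁻¹)  ≈⟨ interchange a c (b ⁻¹) (c ⁻¹) ⟩
    (a * b ⁻¹) * (c * c ⁻¹)  ≈⟨ ∙-congˡ (inverseʳ c) ⟩
    (a * b ⁻¹) * 1#          ≈⟨ identityʳ _ ⟩
    a * b ⁻¹                 ∎

  toggle-doubling : ∀ a x u → (a + a) * (x * (u + u)) ⁻¹ ≈ a * (x * u) ⁻¹
  toggle-doubling a x u = begin
    (a + a) * (x * (u + u)) ⁻¹    ≈⟨ ∙-cong (x+x≈x*2 a) (⁻¹-cong (∙-congˡ (x+x≈x*2 u))) ⟩
    (a * 2#) * (x * (u * 2#)) ⁻¹  ≈⟨ ∙-congˡ (⁻¹-cong (assoc x u 2#)) ⟨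
    (a * 2#) * ((x * u) * 2#) ⁻¹  ≈⟨ *-cancelʳ-quotient a (x * u) 2# ⟩
    a * (x * u) ⁻¹                ∎

  half⁻¹ : ∀ κ → (κ * 2# ⁻¹) ⁻¹ ≈ κ ⁻¹ + κ ⁻¹
  half⁻¹ κ = begin
    (κ * 2# ⁻¹) ⁻¹      ≈⟨ ⁻¹-∙-comm κ (2# ⁻¹) ⟨
    κ ⁻¹ * 2# ⁻¹ ⁻¹     ≈⟨ ∙-congˡ (⁻¹-involutive 2#) ⟩
    κ ⁻¹ * 2#           ≈⟨ x+x≈x*2 (κ ⁻¹) ⟨
    κ ⁻¹ + κ ⁻¹         ∎

module UniqueLists {A : Set} where
  open import Data.Empty using (⊥-elim)
  open import Data.List using (List; []; _∷_)
  open import Data.List.Membership.Propositional using (_∈_)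
  open import Data.List.Relation.Unary.Any using (here; there)
  open import Data.List.Relation.Unary.All using (_∷_)
  open import Data.List.Relation.Unary.AllPairs using (_∷_)
  open import Data.List.Relation.Unary.Unique.Propositional using (Unique)
  open import Data.Product using (_×_; _,_; ∃-syntax)
  open import Data.Sum using (_⊎_; inj₁; inj₂; [_,_])
  import Data.Sum
  open import Function using (id)
  open import Function.Bundles using (_⇔_; mk⇔; Equivalence)
  open import Relation.Binary.PropositionalEquality using (_≡_; _≢_; refl; sym; trans; cong)
  open Equivalence using (to; from)

  unique-singleton : ∀ {a : A} {L} → Unique L → (∀ {y} → y ∈ L ⇔ y ≡ a) → L ≡ a ∷ []
  unique-singleton {L = []} _ m with from m refl
  ... | ()
  unique-singleton {L = x ∷ []} _ m = cong (_∷ []) (to m (here refl))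
  unique-singleton {L = x ∷ y ∷ _} ((x≢y ∷ _) ∷ _) m =
    ⊥-elim (x≢y (trans (to m (here refl)) (sym (to m (there (here refl))))))

  unique-pair : ∀ {a b : A} {L} → Unique L → a ≢ b → (∀ {y} → y ∈ L ⇔ (y ≡ a ⊎ y ≡ b)) →
                L ≡ a ∷ b ∷ [] ⊎ L ≡ b ∷ a ∷ []
  unique-pair {L = []} _ _ m with from m (inj₁ refl)
  ... | ()
  unique-pair {L = x ∷ []} _ a≢b m with from m (inj₁ refl) | from m (inj₂ refl)
  ... | here refl | here refl = ⊥-elim (a≢b refl)
  ... | there () | _
  ... | _ | there ()
  unique-pair {L = x ∷ y ∷ []} ((x≢y ∷ _) ∷ _) _ m with to m (here refl) | to m (there (here refl))
  ... | inj₁ refl | inj₁ refl = ⊥-elim (x≢y refl)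
  ... | inj₁ refl | inj₂ refl = inj₁ refl
  ... | inj₂ refl | inj₁ refl = inj₂ refl
  ... | inj₂ refl | inj₂ refl = ⊥-elim (x≢y refl)
  unique-pair {L = x ∷ y ∷ z ∷ _} ((x≢y ∷ x≢z ∷ _) ∷ (y≢z ∷ _) ∷ _) _ m
    with to m (here refl) | to m (there (here refl)) | to m (there (there (here refl)))
  ... | inj₁ refl | inj₁ refl | _         = ⊥-elim (x≢y refl)
  ... | inj₂ refl | inj₂ refl | _         = ⊥-elim (x≢y refl)
  ... | inj₁ refl | inj₂ refl | inj₁ refl = ⊥-elim (x≢z refl)
  ... | inj₁ refl | inj₂ refl | inj₂ refl = ⊥-elim (y≢z refl)
  ... | inj₂ refl | inj₁ refl | inj₁ refl = ⊥-elim (y≢z refl)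
  ... | inj₂ refl | inj₁ refl | inj₂ refl = ⊥-elim (x≢z refl)

  image-singleton : ∀ {B : Set} {f : A → B} {LA : List A} {LB : List B} {a} →
    (∀ {y} → y ∈ LB ⇔ (∃[ z ] z ∈ LA × y ≡ f z)) → (∀ {z} → z ∈ LA ⇔ z ≡ a) → ∀ {y} → y ∈ LB ⇔ y ≡ f a
  image-singleton LB⇔ LA⇔ = mk⇔
    (λ m → let (z , mz , y≡) = to LB⇔ m in trans y≡ (cong _ (to LA⇔ mz)))
    (λ { refl → from LB⇔ (_ , from LA⇔ refl , refl) })

  image-pair : ∀ {B : Set} {f : A → B} {LA : List A} {LB : List B} {a b} →
    (∀ {y} → y ∈ LB ⇔ (∃[ z ] z ∈ LA × y ≡ f z)) → (∀ {z} → z ∈ LA ⇔ (z ≡ a ⊎ z ≡ b)) →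
    ∀ {y} → y ∈ LB ⇔ (y ≡ f a ⊎ y ≡ f b)
  image-pair {f = f} LB⇔ LA⇔ = mk⇔
    (λ m → let (z , mz , y≡) = to LB⇔ m in Data.Sum.map (λ z≡a → trans y≡ (cong f z≡a)) (λ z≡b → trans y≡ (cong f z≡b)) (to LA⇔ mz))
    (λ { (inj₁ refl) → from LB⇔ (_ , from LA⇔ (inj₁ refl) , refl)
       ; (inj₂ refl) → from LB⇔ (_ , from LA⇔ (inj₂ refl) , refl) })

  image-pair-collapse : ∀ {B : Set} {f : A → B} {LA : List A} {LB : List B} {a b} →
    (∀ {y} → y ∈ LB ⇔ (∃[ z ] z ∈ LA × y ≡ f z)) → (∀ {z} → z ∈ LA ⇔ (z ≡ a ⊎ z ≡ b)) → f a ≡ f b →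
    ∀ {y} → y ∈ LB ⇔ y ≡ f a
  image-pair-collapse LB⇔ LA⇔ fa≡fb = mk⇔
    (λ m → [ id , (λ y≡fb → trans y≡fb (sym fa≡fb)) ] (to (image-pair LB⇔ LA⇔) m))
    (λ y≡fa → from (image-pair LB⇔ LA⇔) (inj₁ y≡fa))

module ToggleProperties (S : PosSemifield) (P : GPoset) where
  open import Data.Empty using (⊥-elim)
  open import Data.Nat using (suc; _≤_; _<_; _≟_)
  open import Data.Nat.Properties using (<-cmp; <⇒≱; ≤-pred)
  open import Data.List using (List; []; _∷_; map; foldl)
  open import Data.List.Membership.Propositional using (_∈_)
  open import Data.List.Membership.Propositional.Properties using (∈-filter⁺; ∈-filter⁻; ∈-map⁺; ∈-map⁻)
  open import Data.List.Relation.Unary.All as All using (All; []; _∷_)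
  open import Data.List.Relation.Unary.AllPairs using (_∷_)
  open import Data.List.Relation.Unary.Any using (here; there)
  open import Data.List.Relation.Unary.Unique.Propositional using (Unique)
  import Data.List.Relation.Unary.Unique.Propositional.Properties as Unique
  open import Data.Product using (_×_; _,_; proj₁; ∃-syntax)
  open import Data.Sum using (_⊎_; inj₁; inj₂)
  open import Function.Bundles using (_⇔_; mk⇔; Equivalence)
  open import Relation.Binary using (tri<; tri≈; tri>)
  open import Relation.Binary.PropositionalEquality using (_≡_; _≢_; refl; cong; subst)
  open import Relation.Nullary using (yes; no)
  open import Algebra.Structures using (IsCommutativeSemigroup; IsCommutativeMonoid)
  open PosSemifield S
  open GPoset P using (X; elems; rank)
  open Toggles S P
  open IsCommutativeSemigroup +-isCommutativeSemigroup using () renaming (refl to ≈-refl; trans to ≈-trans; ∙-cong to +-cong; comm to +-comm)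
  open IsCommutativeMonoid *-isCommutativeMonoid using () renaming (∙-cong to *-cong)
  open UniqueLists
  open Equivalence using (to)

  el-injective : ∀ {x y : X} → _≡_ {A = Hat X} (el x) (el y) → x ≡ y
  el-injective refl = refl

  el∈hatElems⁻ : ∀ {x} → el x ∈ hatElems → x ∈ elems
  el∈hatElems⁻ (there (there m)) with ∈-map⁻ el m
  ... | _ , m′ , refl = m′

  el∈hatElems⁺ : ∀ {x} → x ∈ elems → el x ∈ hatElems
  el∈hatElems⁺ m = there (there (∈-map⁺ el m))

  hatElems-unique : Unique elems → Unique hatElems
  hatElems-unique u = All.tabulate bot≢ ∷ All.tabulate top≢ ∷ Unique.map⁺ el-injective u
    where
    bot≢ : ∀ {y} → y ∈ top ∷ map el elems → bot ≢ y
    bot≢ (here refl) ()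
    bot≢ (there m) e with ∈-map⁻ el m
    bot≢ (there m) () | _ , _ , refl
    top≢ : ∀ {y} → y ∈ map el elems → top ≢ y
    top≢ m e with ∈-map⁻ el m
    top≢ m () | _ , _ , refl

  ∈lowerCovers : ∀ {y p} → y ∈ lowerCovers p ⇔ (y ∈ hatElems × y ⋖ p)
  ∈lowerCovers {p = p} = mk⇔ (∈-filter⁻ (_⋖? p)) (λ (m , c) → ∈-filter⁺ (_⋖? p) m c)

  ∈upperCovers : ∀ {y p} → y ∈ upperCovers p ⇔ (y ∈ hatElems × p ⋖ y)
  ∈upperCovers {p = p} = mk⇔ (∈-filter⁻ (p ⋖?_)) (λ (m , c) → ∈-filter⁺ (p ⋖?_) m c)

  lowerCovers-unique : Unique elems → ∀ p → Unique (lowerCovers p)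
  lowerCovers-unique u p = Unique.filter⁺ (_⋖? p) (hatElems-unique u)

  upperCovers-unique : Unique elems → ∀ p → Unique (upperCovers p)
  upperCovers-unique u p = Unique.filter⁺ (p ⋖?_) (hatElems-unique u)

  sum⁺-singleton : ∀ (g : Hat X → Carrier) {L a} → Unique L → (∀ {y} → y ∈ L ⇔ y ≡ a) →
                   sum⁺ (map g L) ≡ g a
  sum⁺-singleton g u m = cong (λ L → sum⁺ (map g L)) (unique-singleton u m)

  sum⁺-pair : ∀ (g : Hat X → Carrier) {L a b} → Unique L → a ≢ b →
              (∀ {y} → y ∈ L ⇔ (y ≡ a ⊎ y ≡ b)) → sum⁺ (map g L) ≈ g a + g b
  sum⁺-pair g u a≢b m with unique-pair u a≢b m
  ... | inj₁ refl = ≈-refl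
  ... | inj₂ refl = +-comm _ _

  ≋-refl : ∀ {π} → π ≋ π
  ≋-refl = All.tabulate (λ _ → ≈-refl)

  ≋-trans : ∀ {π σ τ} → π ≋ σ → σ ≋ τ → π ≋ τ
  ≋-trans π≋σ σ≋τ = All.tabulate λ m → ≈-trans (All.lookup π≋σ m) (All.lookup σ≋τ m)

  val-cong : ∀ κ {π σ} → π ≋ σ → ∀ {y} → y ∈ hatElems → val κ π y ≈ val κ σ y
  val-cong κ e {bot}  _ = ≈-refl
  val-cong κ e {el x} m = All.lookup e (el∈hatElems⁻ m)
  val-cong κ e {top}  _ = ≈-refl

  sum⁺-cong : ∀ {f g : Hat X → Carrier} L → All (λ y → f y ≈ g y) L → sum⁺ (map f L) ≈ sum⁺ (map g L)
  sum⁺-cong []      _        = ≈-refl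
  sum⁺-cong (_ ∷ L) (e ∷ es) = foldl-cong L e es
    where
    foldl-cong : ∀ {f g : Hat X → Carrier} {a b} L → a ≈ b → All (λ y → f y ≈ g y) L →
                 foldl _+_ a (map f L) ≈ foldl _+_ b (map g L)
    foldl-cong []      a≈b _        = a≈b
    foldl-cong (_ ∷ L) a≈b (e ∷ es) = foldl-cong L (+-cong a≈b e) es

  toggleVal-cong : ∀ κ {π σ} → π ≋ σ → ∀ {x} → x ∈ elems → toggleVal κ π x ≈ toggleVal κ σ x
  toggleVal-cong κ e {x} m = *-cong
    (sum⁺-cong (lowerCovers (el x)) (All.tabulate λ m′ → val-cong κ e (proj₁ (to (∈lowerCovers {p = el x}) m′))))
    (⁻¹-cong (*-cong (All.lookup e m)
      (sum⁺-cong (upperCovers (el x)) (All.tabulate λ m′ → ⁻¹-cong (val-cong κ e (proj₁ (to (∈upperCovers {p = el x}) m′)))))))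

  t-on-rank : ∀ κ i π x → rank x ≡ i → t κ i π x ≡ toggleVal κ π x
  t-on-rank κ i π x r with rank x ≟ i
  ... | yes _  = refl
  ... | no r≢i = ⊥-elim (r≢i r)

  t-off-rank : ∀ κ i π x → rank x ≢ i → t κ i π x ≡ π x
  t-off-rank κ i π x r≢i with rank x ≟ i
  ... | yes r = ⊥-elim (r≢i r)
  ... | no _  = refl

  t-cong : ∀ κ i {π σ} → π ≋ σ → t κ i π ≋ t κ i σ
  t-cong κ i {π} {σ} e = All.tabulate λ {x} m → pointwise x m
    where
    pointwise : ∀ x → x ∈ elems → t κ i π x ≈ t κ i σ x
    pointwise x m with rank x ≟ i
    ... | yes _ = toggleVal-cong κ e m
    ... | no _  = All.lookup e m

  module CoverByRank (h : Hat X → ℕ)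
    (h-mono : ∀ {a b} → a ∈ hatElems → b ∈ hatElems → a <̂ b → h a < h b)
    (h-fill : ∀ {a b} → a ∈ hatElems → b ∈ hatElems → a <̂ b → suc (h a) < h b →
              ∃[ c ] c ∈ hatElems × a <̂ c × c <̂ b) where

    ⋖⇔rank-step : ∀ {a b} → a ∈ hatElems → b ∈ hatElems → a ⋖ b ⇔ (a <̂ b × h b ≡ suc (h a))
    ⋖⇔rank-step {a} {b} ma mb = mk⇔ cover⇒ cover⇐
      where
      cover⇒ : a ⋖ b → a <̂ b × h b ≡ suc (h a)
      cover⇒ (a<b , nothing-between) with <-cmp (h b) (suc (h a))
      ... | tri< gap<1 _ _ = ⊥-elim (<⇒≱ gap<1 (h-mono ma mb a<b))
      ... | tri≈ _ step _ = a<b , step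
      ... | tri> _ _ gap>1 with h-fill ma mb a<b gap>1
      ...   | c , mc , a<c , c<b = ⊥-elim (All.lookup nothing-between mc (a<c , c<b))
      cover⇐ : a <̂ b × h b ≡ suc (h a) → a ⋖ b
      cover⇐ (a<b , step) = a<b , All.tabulate λ {c} mc (a<c , c<b) →
        <⇒≱ (h-mono ma mc a<c) (≤-pred (subst (suc (h c) ≤_) step (h-mono mc mb c<b)))

module Intertwining (S : PosSemifield) (P Q : GPoset) (κP κQ : PosSemifield.Carrier S)
  (f : Toggles.Lab S P → Toggles.Lab S Q)
  (f-t : ∀ π i → Toggles._≋_ S Q (f (Toggles.t S P κP i π)) (Toggles.t S Q κQ i (f π))) where
  open import Data.List using (List; []; _∷_)
  module TP = Toggles S P
  open Toggles S Q
  open ToggleProperties S Q using (≋-refl; ≋-trans; t-cong)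

  tSeq-intertwines : ∀ is π → f (TP.tSeq κP is π) ≋ tSeq κQ is (f π)
  tSeq-intertwines []       π = ≋-refl
  tSeq-intertwines (i ∷ is) π = ≋-trans (f-t (TP.tSeq κP is π) i) (t-cong κQ i (tSeq-intertwines is π))

  rvacSeq-intertwines : ∀ r ks π → f (TP.rvacSeq κP r ks π) ≋ rvacSeq κQ r ks (f π)
  rvacSeq-intertwines r []       π = ≋-refl
  rvacSeq-intertwines r (k ∷ ks) π =
    ≋-trans (tSeq-intertwines (range k r) (TP.rvacSeq κP r ks π)) (tSeq-cong (range k r) (rvacSeq-intertwines r ks π))
    where
    tSeq-cong : ∀ is {π σ} → π ≋ σ → tSeq κQ is π ≋ tSeq κQ is σ
    tSeq-cong []       e = e
    tSeq-cong (i ∷ is) e = t-cong κQ i (tSeq-cong is e)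

module Intervals (n : ℕ) where
  open import Data.Bool using (T; T?; true; false; _∧_)
  open import Data.Bool.Properties using (T-∧)
  open import Data.Empty using (⊥-elim)
  open import Data.List using ([]; _∷_; map; concatMap; cartesianProduct; upTo; _++_)
  open import Data.List.Membership.Propositional using (_∈_)
  open import Data.List.Membership.Propositional.Properties using (∈-filter⁺; ∈-filter⁻; ∈-cartesianProduct⁺; ∈-upTo⁺)
  open import Data.List.Relation.Unary.Unique.Propositional using (Unique)
  import Data.List.Relation.Unary.Unique.Propositional.Properties as Unique
  open import Data.Nat using (zero; suc; _+_; _*_; _∸_; _≤_; _<_; z≤n; s≤s; _≤?_; _<?_; _≟_)
  open import Data.Nat.Properties
  open import Data.Nat.Solver using (module +-*-Solver)
  open +-*-Solver using (solve; _:+_; _:=_)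
  open import Data.Product using (_×_; _,_; proj₁; proj₂; ∃-syntax)
  open import Data.Sum using (_⊎_; inj₁; inj₂)
  open import Data.Unit using (tt)
  open import Function.Bundles using (_⇔_; mk⇔; Equivalence)
  open import Relation.Binary.PropositionalEquality
  open import Relation.Nullary using (¬_; Dec; yes; no)
  open Equivalence using (to; from)

  M N : ℕ
  M = 2 * n
  N = suc M

  data Valid : Pair → Set where
    valid : ∀ {i j} → 1 ≤ i → i ≤ j → j ≤ M → Valid (i , j)

  Canonical : Pair → Set
  Canonical (i , j) = i + j ≤ N

  -- For valid p this says Flip n p ≡ p.
  FlipFixed : Pair → Set
  FlipFixed (i , j) = i + j ≡ N

  validA⇔Valid : ∀ p → T (validA n p) ⇔ Valid p
  validA⇔Valid (i , j) = mk⇔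
    (λ t → let (1≤i , rest) = to T-∧ t ; (i≤j , j≤M) = to T-∧ rest in
           valid (≤ᵇ⇒≤ 1 i 1≤i) (≤ᵇ⇒≤ i j i≤j) (≤ᵇ⇒≤ j M j≤M))
    valid⇒T
    where
    valid⇒T : Valid (i , j) → T (validA n (i , j))
    valid⇒T (valid 1≤i i≤j j≤M) = from T-∧ (≤⇒≤ᵇ 1≤i , from T-∧ (≤⇒≤ᵇ i≤j , ≤⇒≤ᵇ j≤M))

  canonical⇔Canonical : ∀ p → T (canonical n p) ⇔ Canonical p
  canonical⇔Canonical (i , j) = mk⇔ (≤ᵇ⇒≤ (i + j) N) ≤⇒≤ᵇ

  pairs≡cartesianProduct : ∀ m → pairs m ≡ cartesianProduct (upTo (suc m)) (upTo (suc m))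
  pairs≡cartesianProduct m = go (upTo (suc m))
    where
    go : ∀ xs → concatMap (λ i → map (i ,_) (upTo (suc m))) xs ≡ cartesianProduct xs (upTo (suc m))
    go []       = refl
    go (x ∷ xs) = cong (map (x ,_) (upTo (suc m)) ++_) (go xs)

  pairs-unique : Unique (pairs M)
  pairs-unique rewrite pairs≡cartesianProduct M = Unique.cartesianProduct⁺ (Unique.upTo⁺ (suc M)) (Unique.upTo⁺ (suc M))

  ∈pairs : ∀ {i j} → i ≤ M → j ≤ M → (i , j) ∈ pairs M
  ∈pairs i≤M j≤M rewrite pairs≡cartesianProduct M = ∈-cartesianProduct⁺ (∈-upTo⁺ (s≤s i≤M)) (∈-upTo⁺ (s≤s j≤M))

  ∈elemsA : ∀ {p} → p ∈ GPoset.elems (A n) ⇔ Valid p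
  ∈elemsA {p} = mk⇔
    (λ m → to (validA⇔Valid p) (proj₂ (∈-filter⁻ (λ q → T? (validA n q)) {xs = pairs M} m)))
    valid⇒∈
    where
    valid⇒∈ : Valid p → p ∈ GPoset.elems (A n)
    valid⇒∈ v@(valid _ i≤j j≤M) = ∈-filter⁺ (λ q → T? (validA n q)) (∈pairs (≤-trans i≤j j≤M) j≤M) (from (validA⇔Valid _) v)

  ∈elemsB : ∀ {p} → p ∈ GPoset.elems (B' n) ⇔ (Valid p × Canonical p)
  ∈elemsB {p} = mk⇔
    (λ m → let (v , c) = to T-∧ (proj₂ (∈-filter⁻ (λ q → T? (validA n q ∧ canonical n q)) {xs = pairs M} m)) in
           to (validA⇔Valid p) v , to (canonical⇔Canonical p) c)
    valid⇒∈
    where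
    valid⇒∈ : Valid p × Canonical p → p ∈ GPoset.elems (B' n)
    valid⇒∈ (v@(valid {i} {j} _ i≤j j≤M) , c) = ∈-filter⁺ (λ q → T? (validA n q ∧ canonical n q)) (∈pairs (≤-trans i≤j j≤M) j≤M)
                                   (from T-∧ (from (validA⇔Valid _) v , from (canonical⇔Canonical (i , j)) c))

  elemsA-unique : Unique (GPoset.elems (A n))
  elemsA-unique = Unique.filter⁺ (λ q → T? (validA n q)) pairs-unique

  elemsB-unique : Unique (GPoset.elems (B' n))
  elemsB-unique = Unique.filter⁺ (λ q → T? (validA n q ∧ canonical n q)) pairs-unique

  Flip-valid : ∀ {p} → Valid p → Valid (Flip n p)
  Flip-valid (valid 1≤i i≤j j≤M) = valid (m<n⇒0<n∸m (s≤s j≤M)) (∸-monoʳ-≤ N i≤j) (∸-monoʳ-≤ N 1≤i)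

  Flip-involutive : ∀ {p} → Valid p → Flip n (Flip n p) ≡ p
  Flip-involutive (valid _ i≤j j≤M) = cong₂ _,_ (m∸[m∸n]≡n (m≤n⇒m≤1+n (≤-trans i≤j j≤M))) (m∸[m∸n]≡n (m≤n⇒m≤1+n j≤M))

  Flip-mono : ∀ {p q} → p ⊆I q → Flip n p ⊆I Flip n q
  Flip-mono (k≤i , j≤l) = ∸-monoʳ-≤ N j≤l , ∸-monoʳ-≤ N k≤i

  Flip-rank : ∀ {p} → Valid p → rankI (Flip n p) ≡ rankI p
  Flip-rank {i , j} (valid _ i≤j j≤M) = begin
    (N ∸ i) ∸ (N ∸ j)              ≡⟨ cong (λ x → (x ∸ i) ∸ (N ∸ j)) (m∸n+n≡m (m≤n⇒m≤1+n j≤M)) ⟨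
    ((N ∸ j) + j) ∸ i ∸ (N ∸ j)    ≡⟨ cong (_∸ (N ∸ j)) (+-∸-assoc (N ∸ j) i≤j) ⟩
    ((N ∸ j) + (j ∸ i)) ∸ (N ∸ j)  ≡⟨ m+n∸m≡n (N ∸ j) (j ∸ i) ⟩
    j ∸ i                          ∎
    where open ≡-Reasoning

  rank-mono : ∀ {p q} → p ⊆I q → rankI p ≤ rankI q
  rank-mono (k≤i , j≤l) = ∸-mono j≤l k≤i

  ⊆∧rank≥⇒⊇ : ∀ {p q} → Valid p → p ⊆I q → rankI q ≤ rankI p → q ⊆I p
  ⊆∧rank≥⇒⊇ {i , j} {k , l} (valid _ i≤j _) (k≤i , j≤l) rq≤rp = ≮⇒≥ k≮i , ≮⇒≥ l≯j
    where
    k≮i : ¬ k < i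
    k≮i k<i = <⇒≱ (≤-<-trans (∸-monoˡ-≤ i j≤l) (∸-monoʳ-< k<i (≤-trans i≤j j≤l))) rq≤rp
    l≯j : ¬ j < l
    l≯j j<l = <⇒≱ (<-≤-trans (∸-monoˡ-< j<l i≤j) (∸-monoʳ-≤ l k≤i)) rq≤rp

  ⊂⇒rank< : ∀ {p q} → Valid p → p ⊆I q → ¬ q ⊆I p → rankI p < rankI q
  ⊂⇒rank< vp p⊆q q⊈p = ≤∧≢⇒< (rank-mono p⊆q) (λ eq → q⊈p (⊆∧rank≥⇒⊇ vp p⊆q (≤-reflexive (sym eq))))

  rank<⇒⊈ : ∀ {p q} → rankI p < rankI q → ¬ q ⊆I p
  rank<⇒⊈ lt q⊆p = <⇒≱ lt (rank-mono q⊆p)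

  rank<M : ∀ {p} → Valid p → rankI p < M
  rank<M (valid 1≤i i≤j j≤M) = ≤-trans (∸-monoʳ-< 1≤i i≤j) j≤M

  Flip-sum : ∀ {i j} → i ≤ N → j ≤ N → ((N ∸ j) + (N ∸ i)) + (i + j) ≡ N + N
  Flip-sum {i} {j} i≤N j≤N = begin
    ((N ∸ j) + (N ∸ i)) + (i + j)  ≡⟨ +-assoc (N ∸ j) (N ∸ i) (i + j) ⟩
    (N ∸ j) + ((N ∸ i) + (i + j))  ≡⟨ cong ((N ∸ j) +_) (+-assoc (N ∸ i) i j) ⟨
    (N ∸ j) + (((N ∸ i) + i) + j)  ≡⟨ cong (λ x → (N ∸ j) + (x + j)) (m∸n+n≡m i≤N) ⟩
    (N ∸ j) + (N + j)              ≡⟨ cong ((N ∸ j) +_) (+-comm N j) ⟩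
    (N ∸ j) + (j + N)              ≡⟨ +-assoc (N ∸ j) j N ⟨
    ((N ∸ j) + j) + N              ≡⟨ cong (_+ N) (m∸n+n≡m j≤N) ⟩
    N + N                          ∎
    where open ≡-Reasoning

  Flip-canonical : ∀ {p} → Valid p → ¬ Canonical p → Canonical (Flip n p)
  Flip-canonical {i , j} (valid _ i≤j j≤M) p-not-canonical = +-cancelʳ-≤ (i + j) _ _
    (subst (_≤ N + (i + j)) (sym (Flip-sum (m≤n⇒m≤1+n (≤-trans i≤j j≤M)) (m≤n⇒m≤1+n j≤M)))
           (+-monoʳ-≤ N (<⇒≤ (≰⇒> p-not-canonical))))

  canon-canonical : ∀ {p} → Canonical p → canon n p ≡ p
  canon-canonical {p} c with canonical n p | from (canonical⇔Canonical p) c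
  ... | true | _ = refl

  canon-not-canonical : ∀ {p} → ¬ Canonical p → canon n p ≡ Flip n p
  canon-not-canonical {p} nc with canonical n p in eq
  ... | true  = ⊥-elim (nc (to (canonical⇔Canonical p) (subst T (sym eq) tt)))
  ... | false = refl

  canonical? : ∀ p → Dec (Canonical p)
  canonical? (i , j) = i + j ≤? N

  canon-valid : ∀ {p} → Valid p → Valid (canon n p) × Canonical (canon n p)
  canon-valid {p} v with canonical? p
  ... | yes c  = subst (λ q → Valid q × Canonical q) (sym (canon-canonical {p} c)) (v , c)
  ... | no nc = subst (λ q → Valid q × Canonical q) (sym (canon-not-canonical {p} nc)) (Flip-valid v , Flip-canonical v nc)

  canon-rank : ∀ {p} → Valid p → rankI (canon n p) ≡ rankI p
  canon-rank {p} v with canonical? p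
  ... | yes c  = cong rankI (canon-canonical {p} c)
  ... | no nc = trans (cong rankI (canon-not-canonical {p} nc)) (Flip-rank v)

  _∈Orb_ : Pair → Pair → Set
  q ∈Orb p = q ≡ p ⊎ q ≡ Flip n p

  ∈Orb-valid : ∀ {p q} → Valid p → q ∈Orb p → Valid q
  ∈Orb-valid v (inj₁ refl) = v
  ∈Orb-valid v (inj₂ refl) = Flip-valid v

  ∈Orb-rank : ∀ {p q} → Valid p → q ∈Orb p → rankI q ≡ rankI p
  ∈Orb-rank v (inj₁ refl) = refl
  ∈Orb-rank v (inj₂ refl) = Flip-rank v

  Flip-∈Orb : ∀ {p q} → Valid p → q ∈Orb p → Flip n q ∈Orb p
  Flip-∈Orb v (inj₁ refl) = inj₂ refl
  Flip-∈Orb v (inj₂ refl) = inj₁ (Flip-involutive v)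

  ∈Orb-sym : ∀ {p q} → Valid p → q ∈Orb p → p ∈Orb q
  ∈Orb-sym v (inj₁ refl) = inj₁ refl
  ∈Orb-sym v (inj₂ refl) = inj₂ (sym (Flip-involutive v))

  ∈Orb-trans : ∀ {p q r} → Valid r → p ∈Orb q → q ∈Orb r → p ∈Orb r
  ∈Orb-trans v (inj₁ refl) q∈r = q∈r
  ∈Orb-trans v (inj₂ refl) q∈r = Flip-∈Orb v q∈r

  ∈Orb-canon : ∀ {p} → Valid p → p ∈Orb canon n p
  ∈Orb-canon {p} v with canonical? p
  ... | yes c  = subst (p ∈Orb_) (sym (canon-canonical {p} c)) (inj₁ refl)
  ... | no nc = subst (p ∈Orb_) (sym (canon-not-canonical {p} nc)) (inj₂ (sym (Flip-involutive v)))

  canonical-Flip-fixed : ∀ {p} → Valid p → Canonical p → Canonical (Flip n p) → Flip n p ≡ p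
  canonical-Flip-fixed {i , j} (valid _ i≤j j≤M) cp cFp = cong₂ _,_
    (trans (cong (_∸ j) (sym sum≡N)) (m+n∸n≡m i j))
    (trans (cong (_∸ i) (sym sum≡N)) (m+n∸m≡n i j))
    where
    sum≡N : i + j ≡ N
    sum≡N = ≤-antisym cp (+-cancelˡ-≤ N _ _
      (subst (_≤ N + (i + j)) (Flip-sum (m≤n⇒m≤1+n (≤-trans i≤j j≤M)) (m≤n⇒m≤1+n j≤M)) (+-monoˡ-≤ (i + j) cFp)))

  canon-∈Orb : ∀ {p q} → Valid p → Canonical p → q ∈Orb p → canon n q ≡ p
  canon-∈Orb v c (inj₁ refl) = canon-canonical c
  canon-∈Orb {p} v c (inj₂ refl) with canonical? (Flip n p)
  ... | yes cF = trans (canon-canonical cF) (canonical-Flip-fixed v c cF)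
  ... | no ncF = trans (canon-not-canonical ncF) (Flip-involutive v)

  canon-Flip : ∀ {p} → Valid p → canon n (Flip n p) ≡ canon n p
  canon-Flip v = let (vc , cc) = canon-valid v in
    canon-∈Orb vc cc (Flip-∈Orb vc (∈Orb-canon v))

  canon≡⇒∈Orb : ∀ {p q} → Valid p → Valid q → canon n p ≡ canon n q → q ∈Orb p
  canon≡⇒∈Orb vp vq eq = ∈Orb-trans vp (subst (_ ∈Orb_) (sym eq) (∈Orb-canon vq)) (∈Orb-sym (proj₁ (canon-valid vp)) (∈Orb-canon vp))

  ∈Orb-common : ∀ {p q r} → Valid q → Valid r → p ∈Orb r → q ∈Orb r → p ∈Orb q
  ∈Orb-common vq vr p∈r q∈r = ∈Orb-trans vq p∈r (∈Orb-sym vr q∈r)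

  flipFixed? : ∀ p → Dec (FlipFixed p)
  flipFixed? (i , j) = i + j ≟ N

  diagonal-not-FlipFixed : ∀ i → ¬ FlipFixed (i , i)
  diagonal-not-FlipFixed i eq = even≢odd i n (trans (cong (i +_) (+-identityʳ i)) eq)

  canon-step≡⇔ : ∀ {i j} → Valid (i , j) → Valid (suc i , suc j) →
                 canon n (i , j) ≡ canon n (suc i , suc j) ⇔ FlipFixed (i , suc j)
  canon-step≡⇔ {i} {j} v@(valid _ i≤j j≤M) v′ = mk⇔ same⇒fixed fixed⇒same
    where
    same⇒fixed : canon n (i , j) ≡ canon n (suc i , suc j) → FlipFixed (i , suc j)
    same⇒fixed eq with canon≡⇒∈Orb v v′ eq
    ... | inj₁ ()
    ... | inj₂ e = trans (cong (i +_) (cong proj₂ e)) (m+[n∸m]≡n (m≤n⇒m≤1+n (≤-trans i≤j j≤M)))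
    fixed⇒same : FlipFixed (i , suc j) → canon n (i , j) ≡ canon n (suc i , suc j)
    fixed⇒same sum = trans (sym (canon-Flip v)) (cong (canon n) (cong₂ _,_
      (trans (cong (_∸ j) (sym sum)) (trans (cong (_∸ j) (+-suc i j)) (m+n∸n≡m (suc i) j)))
      (trans (cong (_∸ i) (sym sum)) (m+n∸m≡n i (suc j)))))

  _≤B_ : Pair → Pair → Set
  p ≤B q = p ≤B[ n ] q

  ≤B⇔⊆-reps : ∀ {p q} → p ≤B q ⇔ (∃[ p′ ] ∃[ q′ ] p′ ∈Orb p × q′ ∈Orb q × p′ ⊆I q′)
  ≤B⇔⊆-reps {p} {q} = mk⇔ reps reps⇒≤B
    where
    reps : p ≤B q → ∃[ p′ ] ∃[ q′ ] p′ ∈Orb p × q′ ∈Orb q × p′ ⊆I q′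
    reps (inj₁ s)               = p , q , inj₁ refl , inj₁ refl , s
    reps (inj₂ (inj₁ s))        = Flip n p , q , inj₂ refl , inj₁ refl , s
    reps (inj₂ (inj₂ (inj₁ s))) = p , Flip n q , inj₁ refl , inj₂ refl , s
    reps (inj₂ (inj₂ (inj₂ s))) = Flip n p , Flip n q , inj₂ refl , inj₂ refl , s
    reps⇒≤B : ∃[ p′ ] ∃[ q′ ] p′ ∈Orb p × q′ ∈Orb q × p′ ⊆I q′ → p ≤B q
    reps⇒≤B (_ , _ , inj₁ refl , inj₁ refl , s) = inj₁ s
    reps⇒≤B (_ , _ , inj₂ refl , inj₁ refl , s) = inj₂ (inj₁ s)
    reps⇒≤B (_ , _ , inj₁ refl , inj₂ refl , s) = inj₂ (inj₂ (inj₁ s))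
    reps⇒≤B (_ , _ , inj₂ refl , inj₂ refl , s) = inj₂ (inj₂ (inj₂ s))

  ≤B-rank : ∀ {p q} → Valid p → Valid q → p ≤B q → rankI p ≤ rankI q
  ≤B-rank vp vq p≤q with to ≤B⇔⊆-reps p≤q
  ... | _ , _ , p′∈p , q′∈q , s = subst₂ _≤_ (∈Orb-rank vp p′∈p) (∈Orb-rank vq q′∈q) (rank-mono s)

  ≤B-canon⇒⊆ : ∀ {p q} → Valid p → Valid q → p ≤B canon n q → ∃[ p′ ] p′ ∈Orb p × p′ ⊆I q
  ≤B-canon⇒⊆ vp vq le with to ≤B⇔⊆-reps le
  ... | p′ , q′ , p′∈p , q′∈ĉq , s with ∈Orb-common vq (proj₁ (canon-valid vq)) q′∈ĉq (∈Orb-canon vq)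
  ...   | inj₁ refl = p′ , p′∈p , s
  ...   | inj₂ refl = Flip n p′ , Flip-∈Orb vp p′∈p , subst (Flip n p′ ⊆I_) (Flip-involutive vq) (Flip-mono s)

  canon-≤B⇒⊆ : ∀ {p q} → Valid p → Valid q → canon n q ≤B p → ∃[ p′ ] p′ ∈Orb p × q ⊆I p′
  canon-≤B⇒⊆ vp vq le with to ≤B⇔⊆-reps le
  ... | q′ , p′ , q′∈ĉq , p′∈p , s with ∈Orb-common vq (proj₁ (canon-valid vq)) q′∈ĉq (∈Orb-canon vq)
  ...   | inj₁ refl = p′ , p′∈p , s
  ...   | inj₂ refl = Flip n p′ , Flip-∈Orb vp p′∈p , subst (_⊆I Flip n p′) (Flip-involutive vq) (Flip-mono s)

  ≤B∧rank≥⇒≥B : ∀ {p q} → Valid p → Valid q → p ≤B q → rankI q ≤ rankI p → q ≤B p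
  ≤B∧rank≥⇒≥B vp vq le r with to ≤B⇔⊆-reps le
  ... | p′ , q′ , p′∈p , q′∈q , s = from ≤B⇔⊆-reps (q′ , p′ , q′∈q , p′∈p ,
        ⊆∧rank≥⇒⊇ (∈Orb-valid vp p′∈p) s (subst₂ _≤_ (sym (∈Orb-rank vq q′∈q)) (sym (∈Orb-rank vp p′∈p)) r))

  <B⇒rank< : ∀ {p q} → Valid p → Valid q → p ≤B q → ¬ q ≤B p → rankI p < rankI q
  <B⇒rank< vp vq le nle = ≤∧≢⇒< (≤B-rank vp vq le) (λ eq → nle (≤B∧rank≥⇒≥B vp vq le (≤-reflexive (sym eq))))

  rank<⇒≰B : ∀ {p q} → Valid p → Valid q → rankI p < rankI q → ¬ q ≤B p
  rank<⇒≰B vp vq lt le = <⇒≱ lt (≤B-rank vq vp le)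

  shrink-valid : ∀ {i j} → Valid (i , suc j) → i ≤ j → Valid (i , j) × Valid (suc i , suc j)
  shrink-valid (valid 1≤i _ sj≤M) i≤j = valid 1≤i i≤j (≤-trans (n≤1+n _) sj≤M) , valid (s≤s z≤n) (s≤s i≤j) sj≤M

  grow-valid : ∀ {i j} → Valid (suc i , j) → 1 ≤ i → j < M → Valid (i , j) × Valid (suc i , suc j)
  grow-valid (valid _ si≤j j≤M) 1≤i j<M = valid 1≤i (≤-trans (n≤1+n _) si≤j) j≤M , valid (s≤s z≤n) (m≤n⇒m≤1+n si≤j) j<M

  ∸-suc : ∀ {i j} → suc i ≤ j → j ∸ i ≡ suc (j ∸ suc i)
  ∸-suc {i} {suc j} (s≤s i≤j) = +-∸-assoc 1 i≤j

  -- Widen p by one step at whichever end q leaves room.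
  ⊆-interpolate : ∀ {p q} → Valid p → Valid q → p ⊆I q → suc (rankI p) < rankI q →
    ∃[ r ] Valid r × p ⊆I r × r ⊆I q × rankI p < rankI r × rankI r < rankI q
  ⊆-interpolate {i , j} {k , l} (valid 1≤i i≤j j≤M) (valid 1≤k k≤l l≤M) (k≤i , j≤l) gap with j <? l
  ... | yes j<l = (i , suc j) , valid 1≤i (m≤n⇒m≤1+n i≤j) (≤-trans j<l l≤M) , (≤-refl , n≤1+n j) , (k≤i , j<l) ,
        subst (j ∸ i <_) (sym r≡) ≤-refl , subst (_< l ∸ k) (sym r≡) gap
    where r≡ : suc j ∸ i ≡ suc (j ∸ i)
          r≡ = +-∸-assoc 1 i≤j
  ... | no j≮l with k <? i
  ...   | no k≮i = ⊥-elim (<⇒≱ (<-trans (n<1+n _) gap) (rank-mono (≮⇒≥ k≮i , ≮⇒≥ j≮l)))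
  ⊆-interpolate {suc i′ , j} {k , l} (valid 1≤i i≤j j≤M) (valid 1≤k k≤l l≤M) (k≤i , j≤l) gap | no j≮l | yes (s≤s k≤i′) =
        (i′ , j) , valid (≤-trans 1≤k k≤i′) (≤-trans (n≤1+n i′) i≤j) j≤M , (n≤1+n i′ , ≤-refl) , (k≤i′ , j≤l) ,
        subst (j ∸ suc i′ <_) (sym r≡) ≤-refl , subst (_< l ∸ k) (sym r≡) gap
    where r≡ : j ∸ i′ ≡ suc (j ∸ suc i′)
          r≡ = ∸-suc i≤j

  one-step-inside : ∀ {k i j l} → k ≤ i → i ≤ j → j ≤ l → l ∸ k ≡ suc (j ∸ i) →
                    (i ≡ k × l ≡ suc j) ⊎ (i ≡ suc k × l ≡ j)
  one-step-inside {k} k≤i i≤j j≤l eq with m≤n⇒∃[o]m+o≡n k≤i | m≤n⇒∃[o]m+o≡n i≤j | m≤n⇒∃[o]m+o≡n j≤l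
  ... | a , refl | b , refl | c , refl = ends a c (+-cancelʳ-≡ b (a + c) 1 widths)
    where
    widths : (a + c) + b ≡ 1 + b
    widths = begin
      (a + c) + b                       ≡⟨ solve 3 (λ a b c → (a :+ c) :+ b := (a :+ b) :+ c) refl a b c ⟩
      (a + b) + c                       ≡⟨ m+n∸m≡n k ((a + b) + c) ⟨
      (k + ((a + b) + c)) ∸ k           ≡⟨ cong (_∸ k) (solve 4 (λ k a b c → k :+ ((a :+ b) :+ c) := ((k :+ a) :+ b) :+ c) refl k a b c) ⟩
      (((k + a) + b) + c) ∸ k           ≡⟨ eq ⟩
      suc (((k + a) + b) ∸ (k + a))     ≡⟨ cong suc (m+n∸m≡n (k + a) b) ⟩
      1 + b                             ∎
      where open ≡-Reasoning
    ends : ∀ a c → a + c ≡ 1 → (k + a ≡ k × ((k + a) + b) + c ≡ suc ((k + a) + b)) ⊎ (k + a ≡ suc k × ((k + a) + b) + c ≡ (k + a) + b)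
    ends zero    (suc zero) refl = inj₁ (+-identityʳ k , +-comm _ 1)
    ends (suc zero) zero    refl = inj₂ (+-comm k 1 , +-identityʳ _)

  full-width : ∀ {i j m} → 1 ≤ i → i ≤ j → j ≤ m → m ≡ suc (j ∸ i) → i ≡ 1 × j ≡ m
  full-width 1≤i i≤j j≤m eq with one-step-inside z≤n i≤j j≤m eq
  ... | inj₁ (refl , _)   = ⊥-elim (<⇒≱ 1≤i z≤n)
  ... | inj₂ (i≡1 , m≡j) = i≡1 , sym m≡j

module IntervalCovers (n : ℕ) (1≤n : 1 ℕ.≤ n) (S : PosSemifield) where
  open import Data.Empty using (⊥-elim)
  open import Data.List.Membership.Propositional using (_∈_)
  open import Data.List.Membership.Propositional.Properties using (∈-map⁻)
  open import Data.List.Relation.Unary.Any using (here; there)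
  open import Data.Nat using (suc; _+_; _∸_; _≤_; _<_; z≤n; s≤s)
  open import Data.Nat.Properties
  open import Data.Nat.Solver using (module +-*-Solver)
  open +-*-Solver using (solve; _:+_; _:=_)
  open import Data.Product using (_×_; _,_; proj₁; proj₂; ∃-syntax)
  open import Data.Sum using (_⊎_; inj₁; inj₂)
  open import Data.Unit using (tt)
  open import Function.Bundles using (_⇔_; mk⇔; Equivalence)
  open import Relation.Binary.PropositionalEquality
  open Equivalence using (to; from)
  open Intervals n
  module TA = Toggles S (A n)
  module TB = Toggles S (B' n)
  module PA = ToggleProperties S (A n)
  module PB = ToggleProperties S (B' n)

  Rep : Pair → Set
  Rep p = Valid p × Canonical p

  data OnHat (V : Pair → Set) : Hat Pair → Set where
    bot : OnHat V bot
    top : OnHat V top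
    el  : ∀ {p} → V p → OnHat V (el p)

  ∈hatElemsA : ∀ {y} → y ∈ TA.hatElems ⇔ OnHat Valid y
  ∈hatElemsA = mk⇔ onHat (λ { bot → here refl ; top → there (here refl) ; (el v) → PA.el∈hatElems⁺ (from ∈elemsA v) })
    where
    onHat : ∀ {y} → y ∈ TA.hatElems → OnHat Valid y
    onHat (here refl) = bot
    onHat (there (here refl)) = top
    onHat (there (there m)) with ∈-map⁻ el m
    ... | _ , m′ , refl = el (to ∈elemsA m′)

  ∈hatElemsB : ∀ {y} → y ∈ TB.hatElems ⇔ OnHat Rep y
  ∈hatElemsB = mk⇔ onHat (λ { bot → here refl ; top → there (here refl) ; (el r) → PB.el∈hatElems⁺ (from ∈elemsB r) })
    where
    onHat : ∀ {y} → y ∈ TB.hatElems → OnHat Rep y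
    onHat (here refl) = bot
    onHat (there (here refl)) = top
    onHat (there (there m)) with ∈-map⁻ el m
    ... | _ , m′ , refl = el (to ∈elemsB m′)

  full : Pair
  full = 1 , M

  1≤M : 1 ≤ M
  1≤M = ≤-trans 1≤n (m≤m+n n (n + 0))

  full-valid : Valid full
  full-valid = valid ≤-refl 1≤M ≤-refl

  full-canonical : Canonical full
  full-canonical = ≤-refl

  ⊆full : ∀ {p} → Valid p → p ⊆I full
  ⊆full (valid 1≤i _ j≤M) = 1≤i , j≤M

  diagonal-valid : ∀ {i j} → Valid (i , j) → Valid (i , i)
  diagonal-valid (valid 1≤i i≤j j≤M) = valid 1≤i ≤-refl (≤-trans i≤j j≤M)

  height : Hat Pair → ℕ
  height bot    = 0
  height (el p) = suc (rankI p)
  height top    = N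

  height-monoA : ∀ {a b} → a ∈ TA.hatElems → b ∈ TA.hatElems → a TA.<̂ b → height a < height b
  height-monoA ma mb a<b with to ∈hatElemsA ma | to ∈hatElemsA mb | a<b
  ... | bot  | bot  | (_ , b≰a) = ⊥-elim (b≰a tt)
  ... | bot  | top  | _         = s≤s z≤n
  ... | bot  | el _ | _         = s≤s z≤n
  ... | top  | top  | (_ , b≰a) = ⊥-elim (b≰a tt)
  ... | el v | top  | _         = s≤s (rank<M v)
  ... | el v | el _ | (s , ns)  = s≤s (⊂⇒rank< v s ns)

  height-fillA : ∀ {a b} → a ∈ TA.hatElems → b ∈ TA.hatElems → a TA.<̂ b → suc (height a) < height b →
                 ∃[ c ] c ∈ TA.hatElems × a TA.<̂ c × c TA.<̂ b
  height-fillA ma mb a<b gap with to ∈hatElemsA ma | to ∈hatElemsA mb | a<b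
  ... | bot | bot | (_ , b≰a) = ⊥-elim (b≰a tt)
  ... | bot | top | _ = el full , from ∈hatElemsA (el full-valid) , (tt , λ ()) , (tt , λ ())
  ... | bot | el {i , j} v@(valid _ i≤j _) | _ = el (i , i) , from ∈hatElemsA (el (diagonal-valid v)) , (tt , λ ()) ,
        ((≤-refl , i≤j) , rank<⇒⊈ (subst (_< j ∸ i) (sym (n∸n≡0 i)) (≤-pred gap)))
  ... | top | top | (_ , b≰a) = ⊥-elim (b≰a tt)
  ... | el v | top | _ = el full , from ∈hatElemsA (el full-valid) ,
        (⊆full v , rank<⇒⊈ (pred-mono-≤ (≤-pred gap))) , (tt , λ ())
  ... | el v | el w | (s , _) with ⊆-interpolate v w s (≤-pred gap)
  ...   | r , vr , p⊆r , r⊆q , p<r , r<q =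
          el r , from ∈hatElemsA (el vr) , (p⊆r , rank<⇒⊈ p<r) , (r⊆q , rank<⇒⊈ r<q)

  height-monoB : ∀ {a b} → a ∈ TB.hatElems → b ∈ TB.hatElems → a TB.<̂ b → height a < height b
  height-monoB ma mb a<b with to ∈hatElemsB ma | to ∈hatElemsB mb | a<b
  ... | bot        | bot        | (_ , b≰a)  = ⊥-elim (b≰a tt)
  ... | bot        | top        | _          = s≤s z≤n
  ... | bot        | el _       | _          = s≤s z≤n
  ... | top        | top        | (_ , b≰a)  = ⊥-elim (b≰a tt)
  ... | el (v , _) | top        | _          = s≤s (rank<M v)
  ... | el (v , _) | el (w , _) | (le , nle) = s≤s (<B⇒rank< v w le nle)

  height-fillB : ∀ {a b} → a ∈ TB.hatElems → b ∈ TB.hatElems → a TB.<̂ b → suc (height a) < height b →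
                 ∃[ c ] c ∈ TB.hatElems × a TB.<̂ c × c TB.<̂ b
  height-fillB ma mb a<b gap with to ∈hatElemsB ma | to ∈hatElemsB mb | a<b
  ... | bot | bot | (_ , b≰a) = ⊥-elim (b≰a tt)
  ... | bot | top | _ = el full , from ∈hatElemsB (el (full-valid , full-canonical)) , (tt , λ ()) , (tt , λ ())
  ... | bot | el {i , j} (v@(valid _ i≤j _) , _) | _ =
        el (canon n (i , i)) , from ∈hatElemsB (el (canon-valid vii)) , (tt , λ ()) ,
        (from ≤B⇔⊆-reps (_ , _ , ∈Orb-canon vii , inj₁ refl , (≤-refl , i≤j)) ,
         rank<⇒≰B (proj₁ (canon-valid vii)) v (subst (_< j ∸ i) (sym (trans (canon-rank vii) (n∸n≡0 i))) (≤-pred gap)))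
    where vii = diagonal-valid v
  ... | top | top | (_ , b≰a) = ⊥-elim (b≰a tt)
  ... | el (v , _) | top | _ = el full , from ∈hatElemsB (el (full-valid , full-canonical)) ,
        (inj₁ (⊆full v) , rank<⇒≰B v full-valid (pred-mono-≤ (≤-pred gap))) , (tt , λ ())
  ... | el (v , _) | el (w , _) | (le , _) with to ≤B⇔⊆-reps le
  ...   | p′ , q′ , p′∈p , q′∈q , s
          with ⊆-interpolate (∈Orb-valid v p′∈p) (∈Orb-valid w q′∈q) s
                 (subst₂ (λ a b → suc a < b) (sym (∈Orb-rank v p′∈p)) (sym (∈Orb-rank w q′∈q)) (≤-pred gap))
  ...     | r , vr , p′⊆r , r⊆q′ , p′<r , r<q′ =
            el (canon n r) , from ∈hatElemsB (el (canon-valid vr)) ,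
            (from ≤B⇔⊆-reps (_ , _ , p′∈p , ∈Orb-canon vr , p′⊆r) ,
             rank<⇒≰B v vĉr (subst₂ _<_ (∈Orb-rank v p′∈p) (sym (canon-rank vr)) p′<r)) ,
            (from ≤B⇔⊆-reps (_ , _ , ∈Orb-canon vr , q′∈q , r⊆q′) ,
             rank<⇒≰B vĉr w (subst₂ _<_ (sym (canon-rank vr)) (∈Orb-rank w q′∈q) r<q′))
    where vĉr = proj₁ (canon-valid vr)

  module CA = PA.CoverByRank height height-monoA height-fillA
  module CB = PB.CoverByRank height height-monoB height-fillB

  StepBelow StepAbove : (Pair → Set) → (Pair → Pair → Set) → Pair → Hat Pair → Set
  StepBelow V _≼_ p y = (y ≡ bot × rankI p ≡ 0) ⊎ (∃[ z ] y ≡ el z × V z × z ≼ p × rankI p ≡ suc (rankI z))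
  StepAbove V _≼_ p y = (y ≡ top × M ≡ suc (rankI p)) ⊎ (∃[ z ] y ≡ el z × V z × p ≼ z × rankI z ≡ suc (rankI p))

  lowerCoverA⇔ : ∀ {p y} → Valid p → y ∈ TA.lowerCovers (el p) ⇔ StepBelow Valid _⊆I_ p y
  lowerCoverA⇔ {p} vp = mk⇔ classify cover
    where
    mp = from ∈hatElemsA (el vp)
    classify : ∀ {y} → y ∈ TA.lowerCovers (el p) → StepBelow Valid _⊆I_ p y
    classify m with to PA.∈lowerCovers m
    ... | my , y⋖p with to ∈hatElemsA my | to (CA.⋖⇔rank-step my mp) y⋖p
    ...   | bot   | _ , step        = inj₁ (refl , suc-injective step)
    ...   | el vz | (z⊆p , _) , step = inj₂ (_ , refl , vz , z⊆p , suc-injective step)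
    ...   | top   | (() , _) , _
    cover : ∀ {y} → StepBelow Valid _⊆I_ p y → y ∈ TA.lowerCovers (el p)
    cover (inj₁ (refl , r≡0)) = from PA.∈lowerCovers (here refl , from (CA.⋖⇔rank-step (here refl) mp) ((tt , λ ()) , cong suc r≡0))
    cover (inj₂ (_ , refl , vz , z⊆p , step)) = from PA.∈lowerCovers (mz , from (CA.⋖⇔rank-step mz mp)
      ((z⊆p , rank<⇒⊈ (≤-reflexive (sym step))) , cong suc step))
      where mz = from ∈hatElemsA (el vz)

  upperCoverA⇔ : ∀ {p y} → Valid p → y ∈ TA.upperCovers (el p) ⇔ StepAbove Valid _⊆I_ p y
  upperCoverA⇔ {p} vp = mk⇔ classify cover
    where
    mp = from ∈hatElemsA (el vp)
    classify : ∀ {y} → y ∈ TA.upperCovers (el p) → StepAbove Valid _⊆I_ p y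
    classify m with to PA.∈upperCovers m
    ... | my , p⋖y with to ∈hatElemsA my | to (CA.⋖⇔rank-step mp my) p⋖y
    ...   | top   | _ , step        = inj₁ (refl , suc-injective step)
    ...   | el vz | (p⊆z , _) , step = inj₂ (_ , refl , vz , p⊆z , suc-injective step)
    ...   | bot   | (() , _) , _
    cover : ∀ {y} → StepAbove Valid _⊆I_ p y → y ∈ TA.upperCovers (el p)
    cover (inj₁ (refl , step)) = from PA.∈upperCovers (there (here refl) , from (CA.⋖⇔rank-step mp (there (here refl))) ((tt , λ ()) , cong suc step))
    cover (inj₂ (_ , refl , vz , p⊆z , step)) = from PA.∈upperCovers (mz , from (CA.⋖⇔rank-step mp mz)
      ((p⊆z , rank<⇒⊈ (≤-reflexive (sym step))) , cong suc step))
      where mz = from ∈hatElemsA (el vz)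

  lowerCoverB⇔ : ∀ {q y} → Rep q → y ∈ TB.lowerCovers (el q) ⇔ StepBelow Rep _≤B_ q y
  lowerCoverB⇔ {q} rq@(vq , _) = mk⇔ classify cover
    where
    mq = from ∈hatElemsB (el rq)
    classify : ∀ {y} → y ∈ TB.lowerCovers (el q) → StepBelow Rep _≤B_ q y
    classify m with to PB.∈lowerCovers m
    ... | my , y⋖q with to ∈hatElemsB my | to (CB.⋖⇔rank-step my mq) y⋖q
    ...   | bot   | _ , step        = inj₁ (refl , suc-injective step)
    ...   | el rw | (w≤q , _) , step = inj₂ (_ , refl , rw , w≤q , suc-injective step)
    ...   | top   | (() , _) , _
    cover : ∀ {y} → StepBelow Rep _≤B_ q y → y ∈ TB.lowerCovers (el q)
    cover (inj₁ (refl , r≡0)) = from PB.∈lowerCovers (here refl , from (CB.⋖⇔rank-step (here refl) mq) ((tt , λ ()) , cong suc r≡0))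
    cover (inj₂ (_ , refl , rw@(vw , _) , w≤q , step)) = from PB.∈lowerCovers (mw , from (CB.⋖⇔rank-step mw mq)
      ((w≤q , rank<⇒≰B vw vq (≤-reflexive (sym step))) , cong suc step))
      where mw = from ∈hatElemsB (el rw)

  upperCoverB⇔ : ∀ {q y} → Rep q → y ∈ TB.upperCovers (el q) ⇔ StepAbove Rep _≤B_ q y
  upperCoverB⇔ {q} rq@(vq , _) = mk⇔ classify cover
    where
    mq = from ∈hatElemsB (el rq)
    classify : ∀ {y} → y ∈ TB.upperCovers (el q) → StepAbove Rep _≤B_ q y
    classify m with to PB.∈upperCovers m
    ... | my , q⋖y with to ∈hatElemsB my | to (CB.⋖⇔rank-step mq my) q⋖y
    ...   | top   | _ , step        = inj₁ (refl , suc-injective step)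
    ...   | el rw | (q≤w , _) , step = inj₂ (_ , refl , rw , q≤w , suc-injective step)
    ...   | bot   | (() , _) , _
    cover : ∀ {y} → StepAbove Rep _≤B_ q y → y ∈ TB.upperCovers (el q)
    cover (inj₁ (refl , step)) = from PB.∈upperCovers (there (here refl) , from (CB.⋖⇔rank-step mq (there (here refl))) ((tt , λ ()) , cong suc step))
    cover (inj₂ (_ , refl , rw@(vw , _) , q≤w , step)) = from PB.∈upperCovers (mw , from (CB.⋖⇔rank-step mq mw)
      ((q≤w , rank<⇒≰B vq vw (≤-reflexive (sym step))) , cong suc step))
      where mw = from ∈hatElemsB (el rw)

  canonHat : Hat Pair → Hat Pair
  canonHat bot    = bot
  canonHat (el p) = el (canon n p)
  canonHat top    = top

  lowerCoversB-image : ∀ {p y} → Valid p →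
    y ∈ TB.lowerCovers (el (canon n p)) ⇔ (∃[ z ] z ∈ TA.lowerCovers (el p) × y ≡ canonHat z)
  lowerCoversB-image {p} vp = mk⇔ lift project
    where
    lift : ∀ {y} → y ∈ TB.lowerCovers (el (canon n p)) → ∃[ z ] z ∈ TA.lowerCovers (el p) × y ≡ canonHat z
    lift m with to (lowerCoverB⇔ (canon-valid vp)) m
    ... | inj₁ (refl , r≡0) = bot , from (lowerCoverA⇔ vp) (inj₁ (refl , trans (sym (canon-rank vp)) r≡0)) , refl
    ... | inj₂ (w , refl , (vw , cw) , w≤ĉp , step) with ≤B-canon⇒⊆ vw vp w≤ĉp
    ...   | w′ , w′∈w , w′⊆p = el w′ ,
            from (lowerCoverA⇔ vp) (inj₂ (w′ , refl , ∈Orb-valid vw w′∈w , w′⊆p ,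
              trans (sym (canon-rank vp)) (trans step (cong suc (sym (∈Orb-rank vw w′∈w)))))) ,
            cong el (sym (canon-∈Orb vw cw w′∈w))
    project : ∀ {y} → (∃[ z ] z ∈ TA.lowerCovers (el p) × y ≡ canonHat z) → y ∈ TB.lowerCovers (el (canon n p))
    project (z , m , refl) with to (lowerCoverA⇔ vp) m
    ... | inj₁ (refl , r≡0) = from (lowerCoverB⇔ (canon-valid vp)) (inj₁ (refl , trans (canon-rank vp) r≡0))
    ... | inj₂ (x , refl , vx , x⊆p , step) = from (lowerCoverB⇔ (canon-valid vp)) (inj₂ (canon n x , refl , canon-valid vx ,
            from ≤B⇔⊆-reps (x , p , ∈Orb-canon vx , ∈Orb-canon vp , x⊆p) ,
            trans (canon-rank vp) (trans step (cong suc (sym (canon-rank vx))))))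

  upperCoversB-image : ∀ {p y} → Valid p →
    y ∈ TB.upperCovers (el (canon n p)) ⇔ (∃[ z ] z ∈ TA.upperCovers (el p) × y ≡ canonHat z)
  upperCoversB-image {p} vp = mk⇔ lift project
    where
    lift : ∀ {y} → y ∈ TB.upperCovers (el (canon n p)) → ∃[ z ] z ∈ TA.upperCovers (el p) × y ≡ canonHat z
    lift m with to (upperCoverB⇔ (canon-valid vp)) m
    ... | inj₁ (refl , step) = top , from (upperCoverA⇔ vp) (inj₁ (refl , trans step (cong suc (canon-rank vp)))) , refl
    ... | inj₂ (w , refl , (vw , cw) , ĉp≤w , step) with canon-≤B⇒⊆ vw vp ĉp≤w
    ...   | w′ , w′∈w , p⊆w′ = el w′ ,
            from (upperCoverA⇔ vp) (inj₂ (w′ , refl , ∈Orb-valid vw w′∈w , p⊆w′ ,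
              trans (∈Orb-rank vw w′∈w) (trans step (cong suc (canon-rank vp))))) ,
            cong el (sym (canon-∈Orb vw cw w′∈w))
    project : ∀ {y} → (∃[ z ] z ∈ TA.upperCovers (el p) × y ≡ canonHat z) → y ∈ TB.upperCovers (el (canon n p))
    project (z , m , refl) with to (upperCoverA⇔ vp) m
    ... | inj₁ (refl , step) = from (upperCoverB⇔ (canon-valid vp)) (inj₁ (refl , trans step (cong suc (sym (canon-rank vp)))))
    ... | inj₂ (x , refl , vx , p⊆x , step) = from (upperCoverB⇔ (canon-valid vp)) (inj₂ (canon n x , refl , canon-valid vx ,
            from ≤B⇔⊆-reps (p , x , ∈Orb-canon vp , ∈Orb-canon vx , p⊆x) ,
            trans (canon-rank vx) (trans step (cong suc (sym (canon-rank vp))))))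

  lowerCoversA-diagonal : ∀ {i y} → Valid (i , i) → y ∈ TA.lowerCovers (el (i , i)) ⇔ y ≡ bot
  lowerCoversA-diagonal {i} v = mk⇔ only-bot (λ { refl → from (lowerCoverA⇔ v) (inj₁ (refl , n∸n≡0 i)) })
    where
    only-bot : ∀ {y} → y ∈ TA.lowerCovers (el (i , i)) → y ≡ bot
    only-bot m with to (lowerCoverA⇔ v) m
    ... | inj₁ (y≡bot , _) = y≡bot
    ... | inj₂ (_ , _ , _ , _ , step) = ⊥-elim (0≢1+n (trans (sym (n∸n≡0 i)) step))

  lowerCoversA-step : ∀ {i j y} → Valid (i , suc j) → i ≤ j →
    y ∈ TA.lowerCovers (el (i , suc j)) ⇔ (y ≡ el (i , j) ⊎ y ≡ el (suc i , suc j))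
  lowerCoversA-step {i} {j} v i≤j = mk⇔ classify cover
    where
    width : suc j ∸ i ≡ suc (j ∸ i)
    width = +-∸-assoc 1 i≤j
    classify : ∀ {y} → y ∈ TA.lowerCovers (el (i , suc j)) → y ≡ el (i , j) ⊎ y ≡ el (suc i , suc j)
    classify m with to (lowerCoverA⇔ v) m
    ... | inj₁ (_ , r≡0) = ⊥-elim (0≢1+n (trans (sym r≡0) width))
    ... | inj₂ (_ , refl , valid _ k≤l _ , (i≤k , l≤sj) , step) with one-step-inside i≤k k≤l l≤sj step
    ...   | inj₁ (refl , refl) = inj₁ refl
    ...   | inj₂ (refl , refl) = inj₂ refl
    cover : ∀ {y} → y ≡ el (i , j) ⊎ y ≡ el (suc i , suc j) → y ∈ TA.lowerCovers (el (i , suc j))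
    cover (inj₁ refl) = from (lowerCoverA⇔ v) (inj₂ (_ , refl , proj₁ (shrink-valid v i≤j) , (≤-refl , n≤1+n j) , width))
    cover (inj₂ refl) = from (lowerCoverA⇔ v) (inj₂ (_ , refl , proj₂ (shrink-valid v i≤j) , (n≤1+n i , ≤-refl) , width))

  upperCoversA-full : ∀ {y} → y ∈ TA.upperCovers (el full) ⇔ y ≡ top
  upperCoversA-full = mk⇔ only-top (λ { refl → from (upperCoverA⇔ full-valid) (inj₁ (refl , M≡suc[M∸1])) })
    where
    M≡suc[M∸1] : M ≡ suc (M ∸ 1)
    M≡suc[M∸1] = trans (sym (m∸n+n≡m 1≤M)) (+-comm (M ∸ 1) 1)
    only-top : ∀ {y} → y ∈ TA.upperCovers (el full) → y ≡ top
    only-top m with to (upperCoverA⇔ full-valid) m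
    ... | inj₁ (y≡top , _) = y≡top
    ... | inj₂ (_ , _ , vz , _ , step) = ⊥-elim (<⇒≱ (≤-reflexive (sym step)) (rank-mono (⊆full vz)))

  upperCoversA-left : ∀ {j y} → Valid (1 , j) → j < M → y ∈ TA.upperCovers (el (1 , j)) ⇔ y ≡ el (1 , suc j)
  upperCoversA-left {j} v@(valid _ 1≤j j≤M) j<M = mk⇔ classify
    (λ { refl → from (upperCoverA⇔ v) (inj₂ (_ , refl , valid ≤-refl (m≤n⇒m≤1+n 1≤j) j<M , (≤-refl , n≤1+n j) , +-∸-assoc 1 1≤j)) })
    where
    classify : ∀ {y} → y ∈ TA.upperCovers (el (1 , j)) → y ≡ el (1 , suc j)
    classify m with to (upperCoverA⇔ v) m
    ... | inj₁ (_ , step) = ⊥-elim (<⇒≢ j<M (proj₂ (full-width ≤-refl 1≤j j≤M step)))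
    ... | inj₂ (_ , refl , valid 1≤k k≤l _ , (k≤1 , j≤l) , step) with one-step-inside k≤1 1≤j j≤l step
    ...   | inj₁ (refl , refl) = refl
    ...   | inj₂ (refl , _) = ⊥-elim (<⇒≱ 1≤k z≤n)

  upperCoversA-right : ∀ {i y} → Valid (suc i , M) → 1 ≤ i → y ∈ TA.upperCovers (el (suc i , M)) ⇔ y ≡ el (i , M)
  upperCoversA-right {i} v@(valid _ si≤M _) 1≤i = mk⇔ classify
    (λ { refl → from (upperCoverA⇔ v) (inj₂ (_ , refl , valid 1≤i (≤-trans (n≤1+n i) si≤M) ≤-refl , (n≤1+n i , ≤-refl) , ∸-suc si≤M)) })
    where
    classify : ∀ {y} → y ∈ TA.upperCovers (el (suc i , M)) → y ≡ el (i , M)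
    classify m with to (upperCoverA⇔ v) m
    ... | inj₁ (_ , step) = ⊥-elim (<⇒≢ 1≤i (sym (suc-injective (proj₁ (full-width (s≤s z≤n) si≤M ≤-refl step)))))
    ... | inj₂ (_ , refl , valid _ k≤l l≤M , (k≤si , M≤l) , step) with one-step-inside k≤si si≤M M≤l step
    ...   | inj₁ (refl , refl) = ⊥-elim (<⇒≱ ≤-refl l≤M)
    ...   | inj₂ (refl , refl) = refl

  upperCoversA-step : ∀ {i j y} → Valid (suc i , j) → 1 ≤ i → j < M →
    y ∈ TA.upperCovers (el (suc i , j)) ⇔ (y ≡ el (i , j) ⊎ y ≡ el (suc i , suc j))
  upperCoversA-step {i} {j} v@(valid _ si≤j j≤M) 1≤i j<M = mk⇔ classify cover
    where
    classify : ∀ {y} → y ∈ TA.upperCovers (el (suc i , j)) → y ≡ el (i , j) ⊎ y ≡ el (suc i , suc j)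
    classify m with to (upperCoverA⇔ v) m
    ... | inj₁ (_ , step) = ⊥-elim (<⇒≢ 1≤i (sym (suc-injective (proj₁ (full-width (s≤s z≤n) si≤j j≤M step)))))
    ... | inj₂ (_ , refl , _ , (k≤si , j≤l) , step) with one-step-inside k≤si si≤j j≤l step
    ...   | inj₁ (refl , refl) = inj₂ refl
    ...   | inj₂ (refl , refl) = inj₁ refl
    cover : ∀ {y} → y ≡ el (i , j) ⊎ y ≡ el (suc i , suc j) → y ∈ TA.upperCovers (el (suc i , j))
    cover (inj₁ refl) = from (upperCoverA⇔ v) (inj₂ (_ , refl , proj₁ (grow-valid v 1≤i j<M) , (n≤1+n i , ≤-refl) , ∸-suc si≤j))
    cover (inj₂ refl) = from (upperCoverA⇔ v) (inj₂ (_ , refl , proj₂ (grow-valid v 1≤i j<M) , (≤-refl , n≤1+n j) , +-∸-assoc 1 si≤j))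

module ToggleEmbedding (n : ℕ) (1≤n : 1 ℕ.≤ n) (S : PosSemifield) (κ : PosSemifield.Carrier S)
                       (π : Toggles.Lab S (B' n)) where
  open import Data.Empty using (⊥-elim)
  open import Data.List using (List; map)
  open import Data.List.Membership.Propositional using (_∈_)
  import Data.List.Relation.Unary.All as All
  open import Data.List.Relation.Unary.Unique.Propositional using (Unique)
  open import Data.Nat using (zero; suc; _≟_; s≤s; z≤n)
  open import Data.Nat.Properties using (m≤n⇒m<n∨m≡n; <⇒≢; +-suc; +-cancelʳ-≡; suc-injective; 0≢1+n)
  open import Data.Product using (_×_; _,_; proj₁; proj₂; ∃-syntax)
  open import Data.Sum using (_⊎_; inj₁; inj₂)
  open import Function.Bundles using (_⇔_; Equivalence)
  open import Relation.Binary.PropositionalEquality using (_≡_; _≢_; refl; sym; trans; cong; cong₂)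
  open import Relation.Nullary using (¬_; Dec; yes; no)
  open import Algebra.Structures using (IsCommutativeSemigroup; IsCommutativeMonoid)
  open Equivalence using (to; from)
  open PosSemifield S
  open IsCommutativeSemigroup +-isCommutativeSemigroup using (reflexive) renaming (refl to ≈-refl; sym to ≈-sym; trans to ≈-trans; ∙-cong to +-cong)
  open IsCommutativeMonoid *-isCommutativeMonoid using () renaming (∙-cong to *-cong)
  open PosSemifieldProperties S using (toggle-doubling; half⁻¹)
  open UniqueLists using (image-singleton; image-pair; image-pair-collapse)
  open Intervals n
  open IntervalCovers n 1≤n S

  σ : TA.Lab
  σ = ι S n π

  κ/2 : Carrier
  κ/2 = half S κ

  DoubledIfFlipFixed : Pair → Carrier → Carrier → Set
  DoubledIfFlipFixed p a b = (FlipFixed p → a ≈ b + b) × (¬ FlipFixed p → a ≈ b)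

  module CoverSums (fA fB : Hat Pair → Carrier) (fA≡fB∘canon : ∀ z → fA (el z) ≡ fB (el (canon n z)))
                   {LA LB : List (Hat Pair)} (LA-unique : Unique LA) (LB-unique : Unique LB)
                   (LB-image : ∀ {y} → y ∈ LB ⇔ (∃[ z ] z ∈ LA × y ≡ canonHat z)) where
    sumA sumB : Carrier
    sumA = TA.sum⁺ (map fA LA)
    sumB = TB.sum⁺ (map fB LB)

    single : ∀ {a} → (∀ {z} → z ∈ LA ⇔ z ≡ a) → sumA ≡ fA a × sumB ≡ fB (canonHat a)
    single LA⇔ = PA.sum⁺-singleton fA LA-unique LA⇔ , PB.sum⁺-singleton fB LB-unique (image-singleton LB-image LA⇔)

    single-agreeing : ∀ {a} → (∀ {z} → z ∈ LA ⇔ z ≡ a) → fA a ≡ fB (canonHat a) → sumA ≡ sumB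
    single-agreeing LA⇔ agree = let (eA , eB) = single LA⇔ in trans eA (trans agree (sym eB))

    module _ {i j} (v : Valid (i , j)) (v′ : Valid (suc i , suc j))
             (LA⇔ : ∀ {z} → z ∈ LA ⇔ (z ≡ el (i , j) ⊎ z ≡ el (suc i , suc j))) where
      sumA≈ : sumA ≈ fA (el (i , j)) + fA (el (suc i , suc j))
      sumA≈ = PA.sum⁺-pair fA LA-unique (λ ()) LA⇔

      pair : DoubledIfFlipFixed (i , suc j) sumA sumB
      pair = fixed , not-fixed
        where
        fixed : FlipFixed (i , suc j) → sumA ≈ sumB + sumB
        fixed b = ≈-trans sumA≈ (reflexive (cong₂ _+_ (trans (fA≡fB∘canon _) (sym eB))
          (trans (fA≡fB∘canon _) (trans (cong (λ q → fB (el q)) (sym ĉ≡)) (sym eB)))))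
          where
          ĉ≡ = from (canon-step≡⇔ v v′) b
          eB : sumB ≡ fB (el (canon n (i , j)))
          eB = PB.sum⁺-singleton fB LB-unique (image-pair-collapse LB-image LA⇔ (cong el ĉ≡))
        not-fixed : ¬ FlipFixed (i , suc j) → sumA ≈ sumB
        not-fixed nb = ≈-trans sumA≈ (≈-trans (reflexive (cong₂ _+_ (fA≡fB∘canon _) (fA≡fB∘canon _)))
          (≈-sym (PB.sum⁺-pair fB LB-unique ĉ≢ (image-pair LB-image LA⇔))))
          where
          ĉ≢ : canonHat (el (i , j)) ≢ canonHat (el (suc i , suc j))
          ĉ≢ e = nb (to (canon-step≡⇔ v v′) (PA.el-injective e))

  gA gB : Hat Pair → Carrier
  gA = TA.val κ/2 σ
  gB = TB.val κ π

  gA≡gB∘canon : ∀ z → gA (el z) ≡ gB (el (canon n z))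
  gA≡gB∘canon _ = refl

  hA hB : Hat Pair → Carrier
  hA y = gA y ⁻¹
  hB y = gB y ⁻¹

  hA≡hB∘canon : ∀ z → hA (el z) ≡ hB (el (canon n z))
  hA≡hB∘canon _ = refl

  lowerSumA lowerSumB upperSumA upperSumB : Pair → Carrier
  lowerSumA p = TA.sum⁺ (map gA (TA.lowerCovers (el p)))
  lowerSumB p = TB.sum⁺ (map gB (TB.lowerCovers (el (canon n p))))
  upperSumA p = TA.sum⁺ (map hA (TA.upperCovers (el p)))
  upperSumB p = TB.sum⁺ (map hB (TB.upperCovers (el (canon n p))))

  module LowerSums {p} (v : Valid p) = CoverSums gA gB gA≡gB∘canon
    (PA.lowerCovers-unique elemsA-unique (el p)) (PB.lowerCovers-unique elemsB-unique (el (canon n p))) (lowerCoversB-image v)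

  module UpperSums {p} (v : Valid p) = CoverSums hA hB hA≡hB∘canon
    (PA.upperCovers-unique elemsA-unique (el p)) (PB.upperCovers-unique elemsB-unique (el (canon n p))) (upperCoversB-image v)

  lowerSum≈ : ∀ {p} → Valid p → DoubledIfFlipFixed p (lowerSumA p) (lowerSumB p)
  lowerSum≈ {i , j} v@(valid _ i≤j _) with m≤n⇒m<n∨m≡n i≤j
  ... | inj₂ refl = (λ b → ⊥-elim (diagonal-not-FlipFixed i b)) ,
                    (λ _ → reflexive (LowerSums.single-agreeing v (lowerCoversA-diagonal v) refl))
  lowerSum≈ {i , suc j} v | inj₁ (s≤s i≤j) =
    let (va , vb) = shrink-valid v i≤j in LowerSums.pair v va vb (lowerCoversA-step v i≤j)

  DoubledIfFlipFixed-shift : ∀ {i j a b} → DoubledIfFlipFixed (i , suc j) a b → DoubledIfFlipFixed (suc i , j) a b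
  DoubledIfFlipFixed-shift {i} {j} (doubled , same) =
    (λ b → doubled (trans (+-suc i j) b)) , (λ nb → same (λ b → nb (trans (sym (+-suc i j)) b)))

  upperSum≈ : ∀ {p} → Valid p → DoubledIfFlipFixed p (upperSumA p) (upperSumB p)
  upperSum≈ {suc zero , j} v@(valid _ _ j≤M) with m≤n⇒m<n∨m≡n j≤M
  ... | inj₂ refl = (λ _ → let (eA , eB) = UpperSums.single v upperCoversA-full in
                            ≈-trans (reflexive eA) (≈-trans (half⁻¹ κ) (reflexive (cong₂ _+_ (sym eB) (sym eB))))) ,
                    (λ nb → ⊥-elim (nb refl))
  ... | inj₁ j<M  = (λ b → ⊥-elim (<⇒≢ j<M (suc-injective b))) ,
                    (λ _ → reflexive (UpperSums.single-agreeing v (upperCoversA-left v j<M) refl))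
  upperSum≈ {suc (suc i) , j} v@(valid _ _ j≤M) with m≤n⇒m<n∨m≡n j≤M
  ... | inj₂ refl = (λ b → ⊥-elim (0≢1+n (sym (+-cancelʳ-≡ M (suc i) 0 (suc-injective b))))) ,
                    (λ _ → reflexive (UpperSums.single-agreeing v (upperCoversA-right v (s≤s z≤n)) refl))
  ... | inj₁ j<M  = let (va , vb) = grow-valid v (s≤s z≤n) j<M in
                    DoubledIfFlipFixed-shift {suc i} {j} (UpperSums.pair v va vb (upperCoversA-step v (s≤s z≤n) j<M))

  toggleVal≈ : ∀ {p} → Valid p → TA.toggleVal κ/2 σ p ≈ TB.toggleVal κ π (canon n p)
  toggleVal≈ {p} v with flipFixed? p
  ... | yes b = ≈-trans (*-cong (proj₁ (lowerSum≈ v) b) (⁻¹-cong (*-cong ≈-refl (proj₁ (upperSum≈ v) b))))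
                        (toggle-doubling _ _ _)
  ... | no nb = *-cong (proj₂ (lowerSum≈ v) nb) (⁻¹-cong (*-cong ≈-refl (proj₂ (upperSum≈ v) nb)))

  t-intertwines : ∀ i → ι S n (TB.t κ i π) TA.≋ TA.t κ/2 i σ
  t-intertwines i = All.tabulate λ {x} m → by-rank (to ∈elemsA m) (rankI x ≟ i)
    where
    by-rank : ∀ {x} → Valid x → Dec (rankI x ≡ i) → TB.t κ i π (canon n x) ≈ TA.t κ/2 i σ x
    by-rank {x} v (yes r) = ≈-trans (reflexive (PB.t-on-rank κ i π (canon n x) (trans (canon-rank v) r)))
      (≈-trans (≈-sym (toggleVal≈ v)) (reflexive (sym (PA.t-on-rank κ/2 i σ x r))))
    by-rank {x} v (no r)  = reflexive (trans (PB.t-off-rank κ i π (canon n x) (λ r′ → r (trans (sym (canon-rank v)) r′)))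
      (sym (PA.t-off-rank κ/2 i σ x r)))

open import Data.Nat using (_≤_; _∸_; _*_; suc)
open import Data.Product using (_×_; _,_)
open import Data.List using (downFrom)

lemma5p5 : (S : PosSemifield) (n : ℕ) → 1 ≤ n → (κ : PosSemifield.Carrier S) →
    ((i : ℕ) → i ≤ 2 * n ∸ 1 → (π : Toggles.Lab S (B' n)) →
      Toggles._≋_ S (A n) (ι S n (Toggles.t S (B' n) κ i π))
        (Toggles.t S (A n) (half S κ) i (ι S n π)))
    × ((π : Toggles.Lab S (B' n)) →
      Toggles._≋_ S (A n) (ι S n (Toggles.rho S (B' n) κ (2 * n ∸ 1) π))
        (Toggles.rho S (A n) (half S κ) (2 * n ∸ 1) (ι S n π)))
    × ((π : Toggles.Lab S (B' n)) →
      Toggles._≋_ S (A n) (ι S n (Toggles.rvac S (B' n) κ (2 * n ∸ 1) π))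
        (Toggles.rvac S (A n) (half S κ) (2 * n ∸ 1) (ι S n π)))
lemma5p5 S n 1≤n κ =
    (λ i _ π → ToggleEmbedding.t-intertwines n 1≤n S κ π i) ,
    tSeq-intertwines (Toggles.range S (A n) 0 r) ,
    rvacSeq-intertwines r (downFrom (suc r))
  where
  r = 2 * n ∸ 1
  open Intertwining S (B' n) (A n) κ (half S κ) (ι S n) (ToggleEmbedding.t-intertwines n 1≤n S κ)
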